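{- If $G$ is a graph on $n\ge1$ vertices with maximum degree $\Delta(G)\le d$, then \[ i(G)^{1/n}\ge i(K_{d+1})^{1/(d+1)}. \]
   Context: Graphs are finite and simple; $i(G)$ denotes the number of independent sets of $G$, including the empty set, and $K_{d+1}$ is the complete graph on $d+1$ vertices (so $i(K_{d+1})=d+2$). -}

module Defs where

open import Data.Nat using (ℕ; zero; suc; _+_)
open import Data.Bool using (Bool; true; false; _∧_; not; if_then_else_)
open import Data.Fin using (Fin)
open import Data.Vec using (Vec; []; _∷_; lookup)
open import Data.List using (List; []; _∷_; map; _++_; length; filter; allFin)
open import Data.Nat.ListAction using (sum)
open import Data.Bool.ListAction using (all)
open import Data.Bool using (T?)
open import Relation.Binary.PropositionalEquality using (_≡_)

record Graph (n : ℕ) : Set where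
  field
    adj    : Fin n → Fin n → Bool
    sym    : ∀ i j → adj i j ≡ adj j i
    irrefl : ∀ i → adj i i ≡ false
open Graph public

degree : ∀ {n} → Graph n → Fin n → ℕ
degree {n} G v = sum (map (λ j → if adj G v j then 1 else 0) (allFin n))

allSubsets : (n : ℕ) → List (Vec Bool n)
allSubsets zero = [] ∷ []
allSubsets (suc n) = map (true ∷_) (allSubsets n) ++ map (false ∷_) (allSubsets n)

isIndependent : ∀ {n} → Graph n → Vec Bool n → Bool
isIndependent {n} G S =
  all (λ i → all (λ j → not (lookup S i ∧ lookup S j ∧ adj G i j)) (allFin n)) (allFin n)

-- i(G): number of independent sets of G (including the empty set)
indepCount : ∀ {n} → Graph n → ℕ
indepCount {n} G = length (filter (λ S → T? (isIndependent G S)) (allSubsets n))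

-- Let g k = ln (2 + k) / (1 + k), so that ln i(K_{k+1}) = (1 + k) g k. We prove the stronger bound
-- ln i(G[U]) ≥ Σ_{u ∈ U} g (deg_U u) for every vertex set U, by induction on |U|: delete a vertex v of
-- maximum degree a and use i(U) = i(U − v) + i(U − N[v]). Writing A = i(U − v), B = i(U − N[v]), AM-GM
-- gives (a+2)^(a+2) A^(a+1) B ≤ (a+1)^(a+1) (A+B)^(a+2), so it suffices to compare the potentials of
-- U, U − v and U − N[v] vertex by vertex; at the neighbours of v this uses that g is decreasing and
-- suitably convex. Since g is decreasing, taking U = V and all degrees ≤ d gives ln i(G) ≥ n g d.
-- Everything is kept in ℕ by raising to the power M = ((d+1)!)^3, which turns e^(M g k) into an integer.
module Submission where

open import Data.Bool using (Bool; true; false; _∧_; _∨_; not; if_then_else_; T; T?)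
open import Data.Bool.ListAction using (all)
open import Data.Bool.Properties using (T-∧)
open import Data.Empty using (⊥-elim)
open import Data.Fin using (Fin; zero; suc; _≟_)
open import Data.List using ([]; _∷_; map; _++_; length; filter; allFin; tabulate)
open import Data.List.Properties using (map-++; map-∘; map-tabulate)
open import Data.List.Relation.Unary.All.Properties using (all⁺; all⁻; tabulate⁺; tabulate⁻)
open import Data.Nat hiding (_≟_)
open import Data.Nat.DivMod using (_/_; m*n/n≡m; m*[n/m]≡n)
open import Data.Nat.Divisibility using (_∣_; divides; ∣-trans; m∣m*n; ∣m⇒∣m*n; *-pres-∣; m≤n⇒m!∣n!)
open import Data.Nat.ListAction using (sum)
open import Data.Nat.ListAction.Properties using (sum-++)
open import Data.Nat.Properties hiding (_≟_)
open import Data.Nat.Tactic.RingSolver using (solve-∀)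
open import Data.Product using (_×_; _,_; proj₁; proj₂; ∃)
open import Data.Sum using (_⊎_; inj₁; inj₂)
open import Data.Vec using (Vec; []; _∷_; lookup; replicate; updateAt)
open import Data.Vec.Properties using (lookup-replicate; lookup∘updateAt; lookup∘updateAt′)
open import Function using (_∘_; id)
open import Function.Bundles using (_⇔_; mk⇔; Equivalence)
open import Relation.Binary.PropositionalEquality
open import Relation.Nullary using (¬_; yes; no; does; contradiction)
import Algebra.Properties.CommutativeMonoid.Sum as CommutativeMonoidSum

open import Defs using (Graph; adj; irrefl; degree; indepCount; isIndependent; allSubsets)

open ≤-Reasoning
open Equivalence using (to; from)

^-distribʳ-* : ∀ m n k → (m * n) ^ k ≡ m ^ k * n ^ k
^-distribʳ-* m n zero = refl
^-distribʳ-* m n (suc k) = trans (cong (m * n *_) (^-distribʳ-* m n k)) (swap m n (m ^ k) (n ^ k))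
  where
  swap : ∀ a b c d → a * b * (c * d) ≡ a * c * (b * d)
  swap = solve-∀

^-exponent-cong : ∀ m k l p q → k * l ≡ p * q → (m ^ k) ^ l ≡ (m ^ p) ^ q
^-exponent-cong m k l p q eq = trans (^-*-assoc m k l) (trans (cong (m ^_) eq) (sym (^-*-assoc m p q)))

^-comm-exponents : ∀ m k l → (m ^ k) ^ l ≡ (m ^ l) ^ k
^-comm-exponents m k l = ^-exponent-cong m k l l k (*-comm k l)

*-cancelˡ-≤′ : ∀ c {m n} → 0 < c → c * m ≤ c * n → m ≤ n
*-cancelˡ-≤′ c 0<c = *-cancelˡ-≤ c {{>-nonZero 0<c}}

*-cancelʳ-≤′ : ∀ c {m n} → 0 < c → m * c ≤ n * c → m ≤ n
*-cancelʳ-≤′ c {m} {n} 0<c = *-cancelʳ-≤ m n c {{>-nonZero 0<c}}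

^-cancelˡ-≤ : ∀ k .{{_ : NonZero k}} {m n} → m ^ k ≤ n ^ k → m ≤ n
^-cancelˡ-≤ k {m} {n} le with m ≤? n
... | yes m≤n = m≤n
... | no m≰n = contradiction le (<⇒≱ (^-monoˡ-< k (≰⇒> m≰n)))

2*[m*[m+o]]≤m*m+[m+o]*[m+o] : ∀ m o → 2 * (m * (m + o)) ≤ m * m + (m + o) * (m + o)
2*[m*[m+o]]≤m*m+[m+o]*[m+o] m o = subst (2 * (m * (m + o)) ≤_) (sym (square m o)) (m≤m+n _ (o * o))
  where
  square : ∀ m o → m * m + (m + o) * (m + o) ≡ 2 * (m * (m + o)) + o * o
  square = solve-∀

2*[m*n]≤m*m+n*n : ∀ m n → 2 * (m * n) ≤ m * m + n * n
2*[m*n]≤m*m+n*n m n with ≤-total m n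
... | inj₁ m≤n with m≤n⇒∃[o]m+o≡n m≤n
...   | o , refl = 2*[m*[m+o]]≤m*m+[m+o]*[m+o] m o
2*[m*n]≤m*m+n*n m n | inj₂ n≤m with m≤n⇒∃[o]m+o≡n n≤m
...   | o , refl = subst₂ _≤_ (cong (2 *_) (*-comm n (n + o))) (+-comm (n * n) _) (2*[m*[m+o]]≤m*m+[m+o]*[m+o] n o)

weighted-am-gm : ∀ m x y → suc m * x ^ m * y ≤ m * x ^ suc m + y ^ suc m
weighted-am-gm zero x y = ≤-reflexive (base x y)
  where
  base : ∀ x y → 1 * 1 * y ≡ 0 * (x * 1) + y * 1
  base = solve-∀
weighted-am-gm (suc m) x y = +-cancelˡ-≤ (m * (x * p) * y) _ _ (begin
    m * (x * p) * y + suc (suc m) * (x * p) * y  ≡⟨ e₁ m x y p ⟩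
    suc m * p * (2 * (x * y))                    ≤⟨ *-monoʳ-≤ (suc m * p) (2*[m*n]≤m*m+n*n x y) ⟩
    suc m * p * (x * x + y * y)                  ≡⟨ e₂ m x y p ⟩
    suc m * (x * (x * p)) + suc m * p * y * y    ≤⟨ +-monoʳ-≤ (suc m * (x * (x * p))) (*-monoˡ-≤ y (weighted-am-gm m x y)) ⟩
    suc m * (x * (x * p)) + (m * (x * p) + y * q) * y      ≡⟨ e₃ m x y p q ⟩
    m * (x * p) * y + (suc m * (x * (x * p)) + y * (y * q)) ∎)
  where
  p = x ^ m
  q = y ^ m
  e₁ : ∀ m x y p → m * (x * p) * y + suc (suc m) * (x * p) * y ≡ suc m * p * (2 * (x * y))
  e₁ = solve-∀
  e₂ : ∀ m x y p → suc m * p * (x * x + y * y) ≡ suc m * (x * (x * p)) + suc m * p * y * y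
  e₂ = solve-∀
  e₃ : ∀ m x y p q → suc m * (x * (x * p)) + (m * (x * p) + y * q) * y ≡ m * (x * p) * y + (suc m * (x * (x * p)) + y * (y * q))
  e₃ = solve-∀

-- Weighted AM-GM applied to x = (2 + k) a and y = (1 + k) (a + b).
am-gm-split : ∀ k a b → (2 + k) ^ (2 + k) * a ^ (1 + k) * b ≤ (1 + k) ^ (1 + k) * (a + b) ^ (2 + k)
am-gm-split k a b = *-cancelˡ-≤′ m z<s (subst₂ _≤_ lhs rhs key)
  where
  m = suc k
  x = suc m * a
  y = m * (a + b)
  key : m * (suc m * x ^ m * b) ≤ y ^ suc m
  key = +-cancelˡ-≤ (m * x ^ suc m) _ _
          (subst (_≤ m * x ^ suc m + y ^ suc m) (split m a b (x ^ m)) (weighted-am-gm m x y))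
    where
    split : ∀ m a b p → suc m * p * (m * (a + b)) ≡ m * ((suc m * a) * p) + m * (suc m * p * b)
    split = solve-∀
  lhs : m * (suc m * x ^ m * b) ≡ m * (suc m ^ suc m * a ^ m * b)
  lhs = trans (cong (λ z → m * (suc m * z * b)) (^-distribʳ-* (suc m) a m)) (assoc m (suc m ^ m) (a ^ m) b)
    where
    assoc : ∀ m c p b → m * (suc m * (c * p) * b) ≡ m * ((suc m * c) * p * b)
    assoc = solve-∀
  rhs : y ^ suc m ≡ m * (m ^ m * (a + b) ^ suc m)
  rhs = trans (^-distribʳ-* m (a + b) (suc m)) (*-assoc m (m ^ m) _)

am-gm-recurrence : ∀ M a A B Φ Φ₁ Φ₂ → Φ₁ ≤ A ^ M → Φ₂ ≤ B ^ M →
  ((1 + a) ^ (1 + a)) ^ M * Φ ^ (2 + a) ≤ ((2 + a) ^ (2 + a)) ^ M * Φ₁ ^ (1 + a) * Φ₂ →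
  Φ ≤ (A + B) ^ M
am-gm-recurrence M a A B Φ Φ₁ Φ₂ Φ₁≤ Φ₂≤ recurrence =
  ^-cancelˡ-≤ (2 + a) (*-cancelˡ-≤′ R (m^n>0 ((1 + a) ^ (1 + a)) {{m^n≢0 (1 + a) (1 + a)}} M) (begin
    R * Φ ^ (2 + a)                                  ≤⟨ recurrence ⟩
    L * Φ₁ ^ (1 + a) * Φ₂                            ≤⟨ *-mono-≤ (*-monoʳ-≤ L (^-monoˡ-≤ (1 + a) Φ₁≤)) Φ₂≤ ⟩
    L * (A ^ M) ^ (1 + a) * B ^ M                    ≡⟨ cong (λ t → L * t * B ^ M) (^-comm-exponents A (1 + a) M) ⟨
    L * (A ^ (1 + a)) ^ M * B ^ M                    ≡⟨ cong (_* B ^ M) (^-distribʳ-* ((2 + a) ^ (2 + a)) (A ^ (1 + a)) M) ⟨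
    ((2 + a) ^ (2 + a) * A ^ (1 + a)) ^ M * B ^ M    ≡⟨ ^-distribʳ-* ((2 + a) ^ (2 + a) * A ^ (1 + a)) B M ⟨
    ((2 + a) ^ (2 + a) * A ^ (1 + a) * B) ^ M        ≤⟨ ^-monoˡ-≤ M (am-gm-split a A B) ⟩
    ((1 + a) ^ (1 + a) * (A + B) ^ (2 + a)) ^ M      ≡⟨ ^-distribʳ-* ((1 + a) ^ (1 + a)) ((A + B) ^ (2 + a)) M ⟩
    R * ((A + B) ^ (2 + a)) ^ M                      ≡⟨ cong (R *_) (^-comm-exponents (A + B) (2 + a) M) ⟩
    R * ((A + B) ^ M) ^ (2 + a)                      ∎))
  where
  R = ((1 + a) ^ (1 + a)) ^ M
  L = ((2 + a) ^ (2 + a)) ^ M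

bernoulli : ∀ s k → s ^ k * (s + suc k) ≤ suc s ^ suc k
bernoulli s zero = ≤-reflexive (base s)
  where
  base : ∀ s → 1 * (s + 1) ≡ suc s * 1
  base = solve-∀
bernoulli s (suc k) = begin
    s * p * (s + suc (suc k))              ≡⟨ e₁ s k p ⟩
    p * (s * (s + suc (suc k)))            ≤⟨ *-monoʳ-≤ p (m≤m+n _ (suc k)) ⟩
    p * (s * (s + suc (suc k)) + suc k)    ≡⟨ e₂ s k p ⟩
    suc s * (p * (s + suc k))              ≤⟨ *-monoʳ-≤ (suc s) (bernoulli s k) ⟩
    suc s * suc s ^ suc k                  ∎
  where
  p = s ^ k
  e₁ : ∀ s k p → s * p * (s + suc (suc k)) ≡ p * (s * (s + suc (suc k)))
  e₁ = solve-∀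
  e₂ : ∀ s k p → p * (s * (s + suc (suc k)) + suc k) ≡ suc s * (p * (s + suc k))
  e₂ = solve-∀

-- (1 + 1/n)^(1+n) is decreasing: Bernoulli's inequality at s = n (2 + n), whose successor is (1 + n)².
euler-antitone : ∀ n → (2 + n) ^ (2 + n) * n ^ (1 + n) ≤ (1 + n) ^ (2 + n) * (1 + n) ^ (1 + n)
euler-antitone n = *-cancelˡ-≤′ (1 + n) z<s (begin
    (1 + n) * ((2 + n) ^ (2 + n) * n ^ (1 + n))   ≡⟨ e₁ n ((2 + n) ^ (1 + n)) (n ^ (1 + n)) ⟩
    (2 + n) ^ (1 + n) * n ^ (1 + n) * (s + (2 + n)) ≡⟨ cong (_* (s + (2 + n))) (^-distribʳ-* (2 + n) n (1 + n)) ⟨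
    s ^ (1 + n) * (s + (2 + n))                   ≤⟨ bernoulli s (1 + n) ⟩
    suc s ^ (2 + n)                                ≡⟨ cong (_^ (2 + n)) (e₂ n) ⟩
    ((1 + n) * (1 + n)) ^ (2 + n)                  ≡⟨ ^-distribʳ-* (1 + n) (1 + n) (2 + n) ⟩
    (1 + n) ^ (2 + n) * (1 + n) ^ (2 + n)          ≡⟨ e₃ (1 + n) ((1 + n) ^ (1 + n)) ⟩
    (1 + n) * ((1 + n) ^ (2 + n) * (1 + n) ^ (1 + n)) ∎)
  where
  s = (2 + n) * n
  e₁ : ∀ n p q → (1 + n) * ((2 + n) * p * q) ≡ p * q * ((2 + n) * n + (2 + n))
  e₁ = solve-∀
  e₂ : ∀ n → suc ((2 + n) * n) ≡ (1 + n) * (1 + n)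
  e₂ = solve-∀
  e₃ : ∀ a p → a * p * (a * p) ≡ a * (a * p * p)
  e₃ = solve-∀

[1+n]^[1+n]≤3*n^[1+n] : ∀ n → 5 ≤ n → (1 + n) ^ (1 + n) ≤ 3 * n ^ (1 + n)
[1+n]^[1+n]≤3*n^[1+n] n 5≤n with m≤n⇒∃[o]m+o≡n 5≤n
... | c , refl = from-5 c
  where
  from-5 : ∀ c → (6 + c) ^ (6 + c) ≤ 3 * (5 + c) ^ (6 + c)
  from-5 zero = ≤ᵇ⇒≤ _ _ _
  from-5 (suc c) = *-cancelʳ-≤′ (k ^ (1 + k)) (m^n>0 k (1 + k)) (begin
      (2 + k) ^ (2 + k) * k ^ (1 + k)          ≤⟨ euler-antitone k ⟩
      (1 + k) ^ (2 + k) * (1 + k) ^ (1 + k)    ≤⟨ *-monoʳ-≤ ((1 + k) ^ (2 + k)) (from-5 c) ⟩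
      (1 + k) ^ (2 + k) * (3 * k ^ (1 + k))    ≡⟨ e ((1 + k) ^ (2 + k)) (k ^ (1 + k)) ⟩
      3 * (1 + k) ^ (2 + k) * k ^ (1 + k)      ∎)
    where
    k = 5 + c
    e : ∀ p q → p * (3 * q) ≡ 3 * p * q
    e = solve-∀

[1+n]^n≤3*n^n : ∀ n → 5 ≤ n → (1 + n) ^ n ≤ 3 * n ^ n
[1+n]^n≤3*n^n n@(suc _) 5≤n = *-cancelʳ-≤′ n z<s (begin
    (1 + n) ^ n * n          ≤⟨ *-monoʳ-≤ ((1 + n) ^ n) (n≤1+n n) ⟩
    (1 + n) ^ n * (1 + n)    ≡⟨ *-comm ((1 + n) ^ n) (1 + n) ⟩
    (1 + n) ^ (1 + n)        ≤⟨ [1+n]^[1+n]≤3*n^[1+n] n 5≤n ⟩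
    3 * n ^ (1 + n)          ≡⟨ e 3 n (n ^ n) ⟩
    3 * n ^ n * n            ∎)
  where
  e : ∀ a n p → a * (n * p) ≡ a * p * n
  e = solve-∀

[2+n]^n≤[1+n]^[1+n] : ∀ n → (2 + n) ^ n ≤ (1 + n) ^ (1 + n)
[2+n]^n≤[1+n]^[1+n] zero = s≤s z≤n
[2+n]^n≤[1+n]^[1+n] (suc n) = *-cancelˡ-≤′ ((2 + n) ^ n) (m^n>0 (2 + n) n) (begin
    (2 + n) ^ n * (3 + n) ^ (1 + n)            ≤⟨ *-monoˡ-≤ ((3 + n) ^ (1 + n)) ([2+n]^n≤[1+n]^[1+n] n) ⟩
    (1 + n) ^ (1 + n) * (3 + n) ^ (1 + n)      ≡⟨ ^-distribʳ-* (1 + n) (3 + n) (1 + n) ⟨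
    ((1 + n) * (3 + n)) ^ (1 + n)              ≤⟨ ^-monoˡ-≤ (1 + n) (subst ((1 + n) * (3 + n) ≤_) (e₁ n) (n≤1+n _)) ⟩
    ((2 + n) * (2 + n)) ^ (1 + n)              ≡⟨ ^-distribʳ-* (2 + n) (2 + n) (1 + n) ⟩
    (2 + n) ^ (1 + n) * (2 + n) ^ (1 + n)      ≡⟨ e₂ (2 + n) ((2 + n) ^ n) ⟩
    (2 + n) ^ n * (2 + n) ^ (2 + n)            ∎)
  where
  e₁ : ∀ n → suc ((1 + n) * (3 + n)) ≡ (2 + n) * (2 + n)
  e₁ = solve-∀
  e₂ : ∀ a p → a * p * (a * p) ≡ p * (a * (a * p))
  e₂ = solve-∀

private
  module Factors (b : ℕ) where
    N = (1 + b) * (3 + b)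

    lhs-factors : (2 + b) ^ (b * (2 + b) * (5 + 2 * b)) ≡ ((2 + b) ^ b) ^ (4 + b) * suc N ^ (b * N)
    lhs-factors = begin-equality
      (2 + b) ^ (b * (2 + b) * (5 + 2 * b))                   ≡⟨ cong ((2 + b) ^_) (e₁ b) ⟩
      (2 + b) ^ (b * (4 + b) + (b * N + b * N))                ≡⟨ ^-distribˡ-+-* (2 + b) (b * (4 + b)) _ ⟩
      (2 + b) ^ (b * (4 + b)) * (2 + b) ^ (b * N + b * N)      ≡⟨ cong (_* (2 + b) ^ (b * N + b * N)) (^-*-assoc (2 + b) b (4 + b)) ⟨
      y ^ (4 + b) * (2 + b) ^ (b * N + b * N)                  ≡⟨ cong (y ^ (4 + b) *_) (^-distribˡ-+-* (2 + b) (b * N) (b * N)) ⟩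
      y ^ (4 + b) * ((2 + b) ^ (b * N) * (2 + b) ^ (b * N))    ≡⟨ cong (y ^ (4 + b) *_) (^-distribʳ-* (2 + b) (2 + b) (b * N)) ⟨
      y ^ (4 + b) * ((2 + b) * (2 + b)) ^ (b * N)              ≡⟨ cong (λ z → y ^ (4 + b) * z ^ (b * N)) (e₂ b) ⟩
      y ^ (4 + b) * suc N ^ (b * N)                             ∎
      where
      y = (2 + b) ^ b
      e₁ : ∀ b → b * (2 + b) * (5 + 2 * b) ≡ b * (4 + b) + (b * ((1 + b) * (3 + b)) + b * ((1 + b) * (3 + b)))
      e₁ = solve-∀
      e₂ : ∀ b → (2 + b) * (2 + b) ≡ suc ((1 + b) * (3 + b))
      e₂ = solve-∀

    rhs-factors : (1 + b) ^ ((1 + b) * (2 + b) * (2 + b)) * (3 + b) ^ (b * (1 + b) * (3 + b)) ≡ ((1 + b) ^ (1 + b)) ^ (4 + b) * N ^ (b * N)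
    rhs-factors = begin-equality
      (1 + b) ^ ((1 + b) * (2 + b) * (2 + b)) * (3 + b) ^ (b * (1 + b) * (3 + b))
        ≡⟨ cong₂ (λ u v → (1 + b) ^ u * (3 + b) ^ v) (e₁ b) (e₂ b) ⟩
      (1 + b) ^ ((1 + b) * (4 + b) + b * N) * (3 + b) ^ (b * N)
        ≡⟨ cong (_* (3 + b) ^ (b * N)) (^-distribˡ-+-* (1 + b) ((1 + b) * (4 + b)) (b * N)) ⟩
      (1 + b) ^ ((1 + b) * (4 + b)) * (1 + b) ^ (b * N) * (3 + b) ^ (b * N)
        ≡⟨ *-assoc ((1 + b) ^ ((1 + b) * (4 + b))) _ _ ⟩
      (1 + b) ^ ((1 + b) * (4 + b)) * ((1 + b) ^ (b * N) * (3 + b) ^ (b * N))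
        ≡⟨ cong₂ _*_ (^-*-assoc (1 + b) (1 + b) (4 + b)) (^-distribʳ-* (1 + b) (3 + b) (b * N)) ⟨
      ((1 + b) ^ (1 + b)) ^ (4 + b) * N ^ (b * N) ∎
      where
      e₁ : ∀ b → (1 + b) * (2 + b) * (2 + b) ≡ (1 + b) * (4 + b) + b * ((1 + b) * (3 + b))
      e₁ = solve-∀
      e₂ : ∀ b → b * (1 + b) * (3 + b) ≡ b * ((1 + b) * (3 + b))
      e₂ = solve-∀

  log-convexity-large : ∀ b → 8 ≤ b →
    (2 + b) ^ (b * (2 + b) * (5 + 2 * b)) ≤ (1 + b) ^ ((1 + b) * (2 + b) * (2 + b)) * (3 + b) ^ (b * (1 + b) * (3 + b))
  log-convexity-large b 8≤b = subst₂ _≤_ (sym lhs-factors) (sym rhs-factors)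
      (*-cancelˡ-≤′ ((1 + b) ^ (4 + b)) (m^n>0 (1 + b) (4 + b)) (begin
        (1 + b) ^ (4 + b) * (y ^ (4 + b) * Q)          ≡⟨ *-assoc ((1 + b) ^ (4 + b)) _ _ ⟨
        (1 + b) ^ (4 + b) * y ^ (4 + b) * Q            ≡⟨ cong (_* Q) (^-distribʳ-* (1 + b) y (4 + b)) ⟨
        ((1 + b) * y) ^ (4 + b) * Q                    ≤⟨ *-mono-≤ (^-monoˡ-≤ (4 + b) y-bound) Q-bound ⟩
        (3 * x) ^ (4 + b) * (3 ^ b * P)                ≡⟨ cong (_* (3 ^ b * P)) (^-distribʳ-* 3 x (4 + b)) ⟩
        3 ^ (4 + b) * x ^ (4 + b) * (3 ^ b * P)        ≡⟨ swap (3 ^ (4 + b)) (x ^ (4 + b)) (3 ^ b) P ⟩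
        3 ^ (4 + b) * 3 ^ b * (x ^ (4 + b) * P)        ≤⟨ *-monoˡ-≤ (x ^ (4 + b) * P) powers-of-3 ⟩
        (1 + b) ^ (4 + b) * (x ^ (4 + b) * P)          ∎))
    where
    open Factors b
    x = (1 + b) ^ (1 + b)
    y = (2 + b) ^ b
    P = N ^ (b * N)
    Q = suc N ^ (b * N)
    y-bound : (1 + b) * y ≤ 3 * x
    y-bound = begin
      (1 + b) * y          ≤⟨ *-monoˡ-≤ y (n≤1+n (1 + b)) ⟩
      (2 + b) * y          ≤⟨ [1+n]^n≤3*n^n (1 + b) (≤-trans (≤ᵇ⇒≤ 5 9 _) (s≤s 8≤b)) ⟩
      3 * x                ∎
    Q-bound : Q ≤ 3 ^ b * P
    Q-bound = begin
      suc N ^ (b * N)     ≡⟨ ^-*-assoc (suc N) b N ⟨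
      (suc N ^ b) ^ N     ≡⟨ ^-comm-exponents (suc N) b N ⟩
      (suc N ^ N) ^ b     ≤⟨ ^-monoˡ-≤ b ([1+n]^n≤3*n^n N (≤-trans (≤ᵇ⇒≤ 5 11 _) (≤-trans (+-monoʳ-≤ 3 8≤b) (m≤m+n (3 + b) (b * (3 + b)))))) ⟩
      (3 * N ^ N) ^ b     ≡⟨ ^-distribʳ-* 3 (N ^ N) b ⟩
      3 ^ b * (N ^ N) ^ b ≡⟨ cong (3 ^ b *_) (^-*-assoc N N b) ⟩
      3 ^ b * N ^ (N * b) ≡⟨ cong (λ m → 3 ^ b * N ^ m) (*-comm N b) ⟩
      3 ^ b * P           ∎
    powers-of-3 : 3 ^ (4 + b) * 3 ^ b ≤ (1 + b) ^ (4 + b)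
    powers-of-3 = begin
      3 ^ (4 + b) * 3 ^ b         ≤⟨ *-monoʳ-≤ (3 ^ (4 + b)) (^-monoʳ-≤ 3 (m≤n+m b 4)) ⟩
      3 ^ (4 + b) * 3 ^ (4 + b)   ≡⟨ ^-distribʳ-* 3 3 (4 + b) ⟨
      9 ^ (4 + b)                 ≤⟨ ^-monoˡ-≤ (4 + b) (s≤s 8≤b) ⟩
      (1 + b) ^ (4 + b)           ∎
    swap : ∀ a f c p → a * f * (c * p) ≡ a * c * (f * p)
    swap = solve-∀

-- With g k = ln (2 + k) / (1 + k), this is (5 + 2 b) g b ≤ (2 + b) g (b - 1) + (3 + b) g (b + 1)
-- multiplied by b (1 + b) (2 + b); for b ≥ 8 it follows from (1 + 1/n)^n ≤ 3.
log-convexity : ∀ b → 1 ≤ b →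
  (2 + b) ^ (b * (2 + b) * (5 + 2 * b)) ≤ (1 + b) ^ ((1 + b) * (2 + b) * (2 + b)) * (3 + b) ^ (b * (1 + b) * (3 + b))
log-convexity 1 _ = ≤ᵇ⇒≤ _ _ _
log-convexity 2 _ = ≤ᵇ⇒≤ _ _ _
log-convexity 3 _ = ≤ᵇ⇒≤ _ _ _
log-convexity 4 _ = ≤ᵇ⇒≤ _ _ _
log-convexity 5 _ = ≤ᵇ⇒≤ _ _ _
log-convexity 6 _ = ≤ᵇ⇒≤ _ _ _
log-convexity 7 _ = ≤ᵇ⇒≤ _ _ _
log-convexity b@(suc (suc (suc (suc (suc (suc (suc (suc _)))))))) _ = log-convexity-large b (m≤m+n 8 _)

shift-weights : ∀ x y z k δ → 0 < z → z ≤ y →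
  y ^ (suc k + suc (suc k)) ≤ x ^ suc k * z ^ suc (suc k) →
  y ^ ((suc k + δ) + suc (suc k + δ)) ≤ x ^ (suc k + δ) * z ^ suc (suc k + δ)
shift-weights x y z k δ 0<z z≤y base =
  ^-cancelˡ-≤ (suc k) (*-cancelʳ-≤′ (z ^ δ) (m^n>0 z {{>-nonZero 0<z}} δ) (begin
    H ^ p * z ^ δ                ≤⟨ *-monoʳ-≤ (H ^ p) (^-monoˡ-≤ δ z≤y) ⟩
    H ^ p * y ^ δ                ≡⟨ y-side ⟨
    (y ^ (p + suc p)) ^ q        ≤⟨ ^-monoˡ-≤ q base ⟩
    (x ^ p * z ^ suc p) ^ q      ≡⟨ xz-side ⟩
    G ^ p * z ^ δ                ∎))
  where
  p = suc k
  q = p + δ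
  G = x ^ q * z ^ suc q
  H = y ^ (q + suc q)
  y-side : (y ^ (p + suc p)) ^ q ≡ H ^ p * y ^ δ
  y-side = begin-equality
    (y ^ (p + suc p)) ^ q           ≡⟨ ^-*-assoc y (p + suc p) q ⟩
    y ^ ((p + suc p) * q)           ≡⟨ cong (y ^_) (e p δ) ⟩
    y ^ ((q + suc q) * p + δ)       ≡⟨ ^-distribˡ-+-* y ((q + suc q) * p) δ ⟩
    y ^ ((q + suc q) * p) * y ^ δ   ≡⟨ cong (_* y ^ δ) (^-*-assoc y (q + suc q) p) ⟨
    H ^ p * y ^ δ                   ∎
    where
    e : ∀ p δ → (p + suc p) * (p + δ) ≡ ((p + δ) + suc (p + δ)) * p + δ
    e = solve-∀
  xz-side : (x ^ p * z ^ suc p) ^ q ≡ G ^ p * z ^ δ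
  xz-side = begin-equality
    (x ^ p * z ^ suc p) ^ q                 ≡⟨ ^-distribʳ-* (x ^ p) (z ^ suc p) q ⟩
    (x ^ p) ^ q * (z ^ suc p) ^ q           ≡⟨ cong₂ _*_ (^-comm-exponents x p q) (^-*-assoc z (suc p) q) ⟩
    (x ^ q) ^ p * z ^ (suc p * q)           ≡⟨ cong (λ m → (x ^ q) ^ p * z ^ m) (e p δ) ⟩
    (x ^ q) ^ p * z ^ (suc q * p + δ)       ≡⟨ cong ((x ^ q) ^ p *_) (^-distribˡ-+-* z (suc q * p) δ) ⟩
    (x ^ q) ^ p * (z ^ (suc q * p) * z ^ δ) ≡⟨ cong (λ m → (x ^ q) ^ p * (m * z ^ δ)) (^-*-assoc z (suc q) p) ⟨
    (x ^ q) ^ p * ((z ^ suc q) ^ p * z ^ δ) ≡⟨ *-assoc ((x ^ q) ^ p) _ _ ⟨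
    (x ^ q) ^ p * (z ^ suc q) ^ p * z ^ δ   ≡⟨ cong (_* z ^ δ) (^-distribʳ-* (x ^ q) (z ^ suc q) p) ⟨
    G ^ p * z ^ δ                           ∎
    where
    e : ∀ p δ → suc p * (p + δ) ≡ suc (p + δ) * p + δ
    e = solve-∀

ratio-≤-trans : ∀ a b x y z w → 0 < z → a * z ≤ y * b → y * w ≤ x * z → a * w ≤ x * b
ratio-≤-trans a b x y z w 0<z az≤yb yw≤xz = *-cancelˡ-≤′ z 0<z (begin
  z * (a * w)   ≡⟨ e₁ z a w ⟩
  w * (a * z)   ≤⟨ *-monoʳ-≤ w az≤yb ⟩
  w * (y * b)   ≡⟨ e₂ w y b ⟩
  y * w * b     ≤⟨ *-monoˡ-≤ b yw≤xz ⟩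
  x * z * b     ≡⟨ e₃ x z b ⟩
  z * (x * b)   ∎)
  where
  e₁ : ∀ z a w → z * (a * w) ≡ w * (a * z)
  e₁ = solve-∀
  e₂ : ∀ w y b → w * (y * b) ≡ y * w * b
  e₂ = solve-∀
  e₃ : ∀ x z b → x * z * b ≡ z * (x * b)
  e₃ = solve-∀

-- For f = e^(M g), f-convex bounds g (1 + c) by a weighted mean of g c and g (2 + c); the weights can be
-- raised because g is decreasing, and Exchange a b then follows by telescoping from b up to a.
module Convexity (f : ℕ → ℕ) (d : ℕ)
  (f-pos : ∀ k → 0 < f k)
  (f-antitone : ∀ k → suc k ≤ d → f (suc k) ≤ f k)
  (f-convex : ∀ c → 2 + c ≤ d → f (1 + c) ^ ((3 + c) + (4 + c)) ≤ f c ^ (3 + c) * f (2 + c) ^ (4 + c))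
  where

  antitone : ∀ {k l} → k ≤ l → l ≤ d → f l ≤ f k
  antitone {k} k≤l l≤d with m≤n⇒∃[o]m+o≡n k≤l
  ... | o , refl = go o l≤d
    where
    go : ∀ o → k + o ≤ d → f (k + o) ≤ f k
    go zero _ = ≤-reflexive (cong f (+-identityʳ k))
    go (suc o) le = ≤-trans (subst (λ m → f m ≤ f (k + o)) (sym (+-suc k o)) (f-antitone (k + o) (subst (_≤ d) (+-suc k o) le)))
                            (go o (≤-trans (+-monoʳ-≤ k (n≤1+n o)) le))

  convex-shifted : ∀ c δ → 2 + c + δ ≤ d →
    f (1 + c) ^ ((3 + c + δ) + (4 + c + δ)) ≤ f c ^ (3 + c + δ) * f (2 + c) ^ (4 + c + δ)
  convex-shifted c δ le = shift-weights (f c) (f (1 + c)) (f (2 + c)) (2 + c) δ (f-pos (2 + c))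
                            (f-antitone (1 + c) 2+c≤d) (f-convex c 2+c≤d)
    where
    2+c≤d : 2 + c ≤ d
    2+c≤d = ≤-trans (m≤m+n (2 + c) δ) le

  Exchange : ℕ → ℕ → Set
  Exchange a b = f a ^ (2 + a) * f (suc b) ^ (3 + a) ≤ f b ^ (2 + a) * f (suc a) ^ (3 + a)

  exchange-step : ∀ b δ → suc (suc (b + δ)) ≤ d → Exchange (suc (b + δ)) (suc b) → Exchange (suc (b + δ)) b
  exchange-step b δ le ih = ratio-≤-trans (f a ^ u) (f (suc a) ^ w) (f b ^ u) (f (suc b) ^ u) (f (2 + b) ^ w) (f (suc b) ^ w)
                              (m^n>0 (f (2 + b)) {{>-nonZero (f-pos (2 + b))}} w) ih
                              (subst (_≤ f b ^ u * f (2 + b) ^ w) (^-distribˡ-+-* (f (suc b)) u w) (convex-shifted b δ le))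
    where
    a = suc (b + δ)
    u = 2 + a
    w = 3 + a

  exchange : ∀ {a b} → b ≤ a → suc a ≤ d → Exchange a b
  exchange {a} {b} b≤a le with m≤n⇒∃[o]m+o≡n b≤a
  ... | o , refl = go o b le
    where
    go : ∀ o b → suc (b + o) ≤ d → Exchange (b + o) b
    go zero b le rewrite +-identityʳ b = ≤-refl
    go (suc o) b le rewrite +-suc b o = exchange-step b o le (go o (suc b) le)

-- f k is e^(M g k) = ((2 + k)^(1/(1 + k)))^M; the division is exact because 1 + k divides M when k ≤ d.
module Potential (d : ℕ) where

  M : ℕ
  M = suc d ! * suc d ! * suc d !

  f : ℕ → ℕ
  f k = (2 + k) ^ (M / suc k)

  f-pos : ∀ k → 0 < f k
  f-pos k = m^n>0 (2 + k) (M / suc k)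

  f-as-power : ∀ k m → M ≡ m * suc k → f k ≡ (2 + k) ^ m
  f-as-power k m eq = trans (cong (λ n → (2 + k) ^ (n / suc k)) eq) (cong ((2 + k) ^_) (m*n/n≡m m (suc k)))

  suc∣d! : ∀ {k} → k ≤ d → suc k ∣ suc d !
  suc∣d! {k} k≤d = ∣-trans (m∣m*n (k !)) (m≤n⇒m!∣n! (s≤s k≤d))

  suc∣M : ∀ {k} → k ≤ d → suc k ∣ M
  suc∣M k≤d = ∣m⇒∣m*n (suc d !) (∣m⇒∣m*n (suc d !) (suc∣d! k≤d))

  suc*suc∣M : ∀ {k l} → k ≤ d → l ≤ d → suc k * suc l ∣ M
  suc*suc∣M k≤d l≤d = ∣m⇒∣m*n (suc d !) (*-pres-∣ (suc∣d! k≤d) (suc∣d! l≤d))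

  suc*suc*suc∣M : ∀ {k l m} → k ≤ d → l ≤ d → m ≤ d → suc k * suc l * suc m ∣ M
  suc*suc*suc∣M k≤d l≤d m≤d = *-pres-∣ (*-pres-∣ (suc∣d! k≤d) (suc∣d! l≤d)) (suc∣d! m≤d)

  f^[1+k] : ∀ {k} → k ≤ d → f k ^ suc k ≡ (2 + k) ^ M
  f^[1+k] {k} k≤d = trans (^-*-assoc (2 + k) (M / suc k) (suc k))
                      (cong ((2 + k) ^_) (trans (*-comm (M / suc k) (suc k)) (m*[n/m]≡n (suc∣M k≤d))))

  f-antitone : ∀ k → suc k ≤ d → f (suc k) ≤ f k
  f-antitone k 1+k≤d with suc*suc∣M (≤-trans (n≤1+n k) 1+k≤d) 1+k≤d
  ... | divides t M≡ = subst₂ _≤_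
          (sym (trans (f-as-power (suc k) (suc k * t) (trans M≡ (e₁ k t))) (sym (^-*-assoc (3 + k) (suc k) t))))
          (sym (trans (f-as-power k (suc (suc k) * t) (trans M≡ (e₂ k t))) (sym (^-*-assoc (2 + k) (2 + k) t))))
          (^-monoˡ-≤ t ([2+n]^n≤[1+n]^[1+n] (suc k)))
    where
    e₁ : ∀ k t → t * (suc k * suc (suc k)) ≡ suc k * t * suc (suc k)
    e₁ = solve-∀
    e₂ : ∀ k t → t * (suc k * suc (suc k)) ≡ suc (suc k) * t * suc k
    e₂ = solve-∀

  f-convex : ∀ c → 2 + c ≤ d → f (1 + c) ^ ((3 + c) + (4 + c)) ≤ f c ^ (3 + c) * f (2 + c) ^ (4 + c)
  f-convex c 2+c≤d with suc*suc*suc∣M (≤-trans (≤-trans (n≤1+n c) (n≤1+n (suc c))) 2+c≤d) (≤-trans (n≤1+n (suc c)) 2+c≤d) 2+c≤d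
  ... | divides t M≡ = subst₂ _≤_ (sym lhs) (sym rhs) (^-monoˡ-≤ t (log-convexity b (s≤s z≤n)))
    where
    b = suc c
    power : ∀ k m → M ≡ m * suc k → ∀ p q → m * p ≡ q * t → f k ^ p ≡ ((2 + k) ^ q) ^ t
    power k m M≡m*[1+k] p q eq = trans (cong (_^ p) (f-as-power k m M≡m*[1+k])) (^-exponent-cong (2 + k) m p q t eq)
    lhs : f b ^ ((3 + c) + (4 + c)) ≡ ((2 + b) ^ (b * (2 + b) * (5 + 2 * b))) ^ t
    lhs = power b (b * (3 + c) * t) (trans M≡ (e₁ c t)) ((3 + c) + (4 + c)) (b * (2 + b) * (5 + 2 * b)) (e₂ c t)
      where
      e₁ : ∀ c t → t * (suc c * suc (suc c) * (3 + c)) ≡ suc c * (3 + c) * t * suc (suc c)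
      e₁ = solve-∀
      e₂ : ∀ c t → suc c * (3 + c) * t * ((3 + c) + (4 + c)) ≡ suc c * (2 + suc c) * (5 + 2 * suc c) * t
      e₂ = solve-∀
    rhs : f c ^ (3 + c) * f (2 + c) ^ (4 + c) ≡ ((1 + b) ^ ((1 + b) * (2 + b) * (2 + b)) * (3 + b) ^ (b * (1 + b) * (3 + b))) ^ t
    rhs = trans (cong₂ _*_ (power c ((2 + c) * (3 + c) * t) (trans M≡ (e₁ c t)) (3 + c) ((1 + b) * (2 + b) * (2 + b)) (e₂ c t))
                           (power (2 + c) (b * (2 + c) * t) (trans M≡ (e₃ c t)) (4 + c) (b * (1 + b) * (3 + b)) (e₄ c t)))
                (sym (^-distribʳ-* ((1 + b) ^ ((1 + b) * (2 + b) * (2 + b))) ((3 + b) ^ (b * (1 + b) * (3 + b))) t))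
      where
      e₁ : ∀ c t → t * (suc c * suc (suc c) * (3 + c)) ≡ (2 + c) * (3 + c) * t * suc c
      e₁ = solve-∀
      e₂ : ∀ c t → (2 + c) * (3 + c) * t * (3 + c) ≡ (1 + suc c) * (2 + suc c) * (2 + suc c) * t
      e₂ = solve-∀
      e₃ : ∀ c t → t * (suc c * suc (suc c) * (3 + c)) ≡ suc c * (2 + c) * t * (3 + c)
      e₃ = solve-∀
      e₄ : ∀ c t → suc c * (2 + c) * t * (4 + c) ≡ suc c * (1 + suc c) * (3 + suc c) * t
      e₄ = solve-∀

  open Convexity f d f-pos f-antitone f-convex public

  instance
    M≢0 : NonZero M
    M≢0 = m*n≢0 (suc d ! * suc d !) (suc d !) {{m*n≢0 (suc d !) (suc d !) {{suc d !≢0}} {{suc d !≢0}}}} {{suc d !≢0}}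

  [f^[2+k]]^[1+k] : ∀ {k} → k ≤ d → (f k ^ (2 + k)) ^ (1 + k) ≡ ((2 + k) ^ (2 + k)) ^ M
  [f^[2+k]]^[1+k] {k} k≤d = begin-equality
    (f k ^ (2 + k)) ^ (1 + k)    ≡⟨ ^-comm-exponents (f k) (2 + k) (1 + k) ⟩
    (f k ^ (1 + k)) ^ (2 + k)    ≡⟨ cong (_^ (2 + k)) (f^[1+k] k≤d) ⟩
    ((2 + k) ^ M) ^ (2 + k)      ≡⟨ ^-comm-exponents (2 + k) M (2 + k) ⟩
    ((2 + k) ^ (2 + k)) ^ M      ∎

  neighbourWeight : ℕ → ℕ
  neighbourWeight zero = 1
  neighbourWeight (suc k) = f k ^ (2 + k)

  neighbourWeight^k : ∀ {k} → k ≤ d → neighbourWeight k ^ k ≡ ((1 + k) ^ (1 + k)) ^ M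
  neighbourWeight^k {zero} _ = sym (^-zeroˡ M)
  neighbourWeight^k {suc k} k≤d = [f^[2+k]]^[1+k] (≤-trans (n≤1+n k) k≤d)

  neighbour-exchange : ∀ {a b} → suc b ≤ a → a ≤ d →
    neighbourWeight a * f (suc b) ^ (2 + a) ≤ f a ^ (2 + a) * f b ^ (1 + a)
  neighbour-exchange {suc a} {b} (s≤s b≤a) a≤d =
    subst (neighbourWeight (suc a) * f (suc b) ^ (3 + a) ≤_) (*-comm (f b ^ (2 + a)) (f (suc a) ^ (3 + a))) (exchange b≤a a≤d)

open CommutativeMonoidSum +-0-commutativeMonoid using (∑-distrib-+; sum-replicate-zero)
  renaming (sum to ∑; sum-cong-≗ to ∑-cong)
open CommutativeMonoidSum *-1-commutativeMonoid using ()
  renaming (sum to ∏; sum-cong-≗ to ∏-cong; ∑-distrib-+ to ∏-distrib-*)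

𝟙 : Bool → ℕ
𝟙 b = if b then 1 else 0

∑-mono : ∀ {n} {g h : Fin n → ℕ} → (∀ i → g i ≤ h i) → ∑ g ≤ ∑ h
∑-mono {zero} _ = z≤n
∑-mono {suc n} g≤h = +-mono-≤ (g≤h zero) (∑-mono (g≤h ∘ suc))

∏-mono : ∀ {n} {g h : Fin n → ℕ} → (∀ i → g i ≤ h i) → ∏ g ≤ ∏ h
∏-mono {zero} _ = ≤-refl
∏-mono {suc n} g≤h = *-mono-≤ (g≤h zero) (∏-mono (g≤h ∘ suc))

∑-point : ∀ {n} (v : Fin n) c → ∑ (λ i → if does (i ≟ v) then c else 0) ≡ c
∑-point {suc n} zero c = trans (cong (c +_) (sum-replicate-zero n)) (+-identityʳ c)
∑-point {suc n} (suc v) c = ∑-point v c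

∏-^ : ∀ {n} (g : Fin n → ℕ) k → ∏ (λ i → g i ^ k) ≡ ∏ g ^ k
∏-^ {zero} g k = sym (^-zeroˡ k)
∏-^ {suc n} g k = trans (cong (g zero ^ k *_) (∏-^ (g ∘ suc) k)) (sym (^-distribʳ-* (g zero) (∏ (g ∘ suc)) k))

∏-const : ∀ n c → ∏ {n} (λ _ → c) ≡ c ^ n
∏-const zero c = refl
∏-const (suc n) c = cong (c *_) (∏-const n c)

∏-indicator : ∀ {n} (b : Fin n → Bool) c → ∏ (λ i → if b i then c else 1) ≡ c ^ ∑ (𝟙 ∘ b)
∏-indicator {zero} b c = refl
∏-indicator {suc n} b c with b zero
... | true = cong (c *_) (∏-indicator (b ∘ suc) c)
... | false = trans (+-identityʳ _) (∏-indicator (b ∘ suc) c)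

∏-point : ∀ {n} (v : Fin n) c → ∏ (λ i → if does (i ≟ v) then c else 1) ≡ c
∏-point v c = trans (∏-indicator (λ i → does (i ≟ v)) c) (trans (cong (c ^_) (∑-point v 1)) (*-identityʳ c))

∑ₛ : ∀ n → (Vec Bool n → ℕ) → ℕ
∑ₛ zero h = h []
∑ₛ (suc n) h = ∑ₛ n (h ∘ (true ∷_)) + ∑ₛ n (h ∘ (false ∷_))

∑ₛ-cong : ∀ n {g h : Vec Bool n → ℕ} → (∀ S → g S ≡ h S) → ∑ₛ n g ≡ ∑ₛ n h
∑ₛ-cong zero g≗h = g≗h []
∑ₛ-cong (suc n) g≗h = cong₂ _+_ (∑ₛ-cong n (g≗h ∘ (true ∷_))) (∑ₛ-cong n (g≗h ∘ (false ∷_)))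

∑ₛ-distrib-+ : ∀ n (g h : Vec Bool n → ℕ) → ∑ₛ n (λ S → g S + h S) ≡ ∑ₛ n g + ∑ₛ n h
∑ₛ-distrib-+ zero g h = refl
∑ₛ-distrib-+ (suc n) g h = trans (cong₂ _+_ (∑ₛ-distrib-+ n (g ∘ (true ∷_)) (h ∘ (true ∷_))) (∑ₛ-distrib-+ n (g ∘ (false ∷_)) (h ∘ (false ∷_))))
                                  (swap (∑ₛ n (g ∘ (true ∷_))) (∑ₛ n (h ∘ (true ∷_))) (∑ₛ n (g ∘ (false ∷_))) (∑ₛ n (h ∘ (false ∷_))))
  where
  swap : ∀ a b c d → a + b + (c + d) ≡ a + c + (b + d)
  swap = solve-∀

∑ₛ-≥-empty : ∀ n (h : Vec Bool n → ℕ) → h (replicate n false) ≤ ∑ₛ n h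
∑ₛ-≥-empty zero h = ≤-refl
∑ₛ-≥-empty (suc n) h = ≤-trans (∑ₛ-≥-empty n (h ∘ (false ∷_))) (m≤n+m _ _)

∑ₛ-toggle : ∀ n (v : Fin n) (h : Vec Bool n → ℕ) → ∑ₛ n (λ S → h (updateAt S v not)) ≡ ∑ₛ n h
∑ₛ-toggle (suc n) zero h = +-comm (∑ₛ n (h ∘ (false ∷_))) (∑ₛ n (h ∘ (true ∷_)))
∑ₛ-toggle (suc n) (suc v) h = cong₂ _+_ (∑ₛ-toggle n v (h ∘ (true ∷_))) (∑ₛ-toggle n v (h ∘ (false ∷_)))

sum-allSubsets : ∀ n (h : Vec Bool n → ℕ) → sum (map h (allSubsets n)) ≡ ∑ₛ n h
sum-allSubsets zero h = +-identityʳ (h [])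
sum-allSubsets (suc n) h = begin-equality
  sum (map h (map (true ∷_) L ++ map (false ∷_) L))                 ≡⟨ cong sum (map-++ h (map (true ∷_) L) _) ⟩
  sum (map h (map (true ∷_) L) ++ map h (map (false ∷_) L))         ≡⟨ sum-++ (map h (map (true ∷_) L)) _ ⟩
  sum (map h (map (true ∷_) L)) + sum (map h (map (false ∷_) L))    ≡⟨ cong₂ _+_ (cong sum (map-∘ L)) (cong sum (map-∘ L)) ⟨
  sum (map (h ∘ (true ∷_)) L) + sum (map (h ∘ (false ∷_)) L)        ≡⟨ cong₂ _+_ (sum-allSubsets n _) (sum-allSubsets n _) ⟩
  ∑ₛ (suc n) h                                                       ∎
  where
  L = allSubsets n

length-filter : ∀ {A : Set} (p : A → Bool) xs → length (filter (λ x → T? (p x)) xs) ≡ sum (map (𝟙 ∘ p) xs)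
length-filter p [] = refl
length-filter p (x ∷ xs) with p x
... | true = cong suc (length-filter p xs)
... | false = length-filter p xs

sum-tabulate : ∀ {n} (g : Fin n → ℕ) → sum (tabulate g) ≡ ∑ g
sum-tabulate {zero} g = refl
sum-tabulate {suc n} g = cong (g zero +_) (sum-tabulate (g ∘ suc))

T-⇔⇒≡ : ∀ {a b} → (T a → T b) → (T b → T a) → a ≡ b
T-⇔⇒≡ {false} {false} _ _ = refl
T-⇔⇒≡ {false} {true} _ b⇒a = ⊥-elim (b⇒a _)
T-⇔⇒≡ {true} {false} a⇒b _ = ⊥-elim (a⇒b _)
T-⇔⇒≡ {true} {true} _ _ = refl

¬T⇒≡false : ∀ {b} → ¬ T b → b ≡ false
¬T⇒≡false {false} _ = refl
¬T⇒≡false {true} ¬b = ⊥-elim (¬b _)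

T-not : ∀ {b} → T (not b) ⇔ (¬ T b)
T-not {false} = mk⇔ (λ _ ()) (λ _ → _)
T-not {true} = mk⇔ (λ ()) (λ ¬b → ¬b _)

T-not-∨ : ∀ {a b} → T (not a ∨ b) ⇔ (T a → T b)
T-not-∨ {false} = mk⇔ (λ _ ()) (λ _ → _)
T-not-∨ {true} = mk⇔ (λ b _ → b) (λ a⇒b → a⇒b _)

T-not-∧∧ : ∀ {a b c} → T (not (a ∧ b ∧ c)) ⇔ (T a → T b → ¬ T c)
T-not-∧∧ {false} = mk⇔ (λ _ ()) (λ _ → _)
T-not-∧∧ {true} {false} = mk⇔ (λ _ _ ()) (λ _ → _)
T-not-∧∧ {true} {true} = mk⇔ (λ ¬c _ _ → to T-not ¬c) (λ h → from T-not (h _ _))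

T-not-≟ : ∀ {n} {u v : Fin n} → T (not (does (u ≟ v))) ⇔ (u ≢ v)
T-not-≟ {u = u} {v} with u ≟ v
... | yes refl = mk⇔ (λ ()) (λ u≢u → u≢u refl)
... | no u≢v = mk⇔ (λ _ → u≢v) (λ _ → _)

T-all-allFin : ∀ {n} (p : Fin n → Bool) → T (all p (allFin n)) ⇔ (∀ i → T (p i))
T-all-allFin p = mk⇔ (λ t → tabulate⁻ (all⁺ p _ t)) (λ h → all⁻ p (tabulate⁺ h))

∧-monoʳ-T : ∀ {a b c} → (T b → T c) → T (a ∧ b) → T (a ∧ c)
∧-monoʳ-T b⇒c t = let a , b = to T-∧ t in from T-∧ (a , b⇒c b)

𝟙-mono : ∀ {a b} → (T a → T b) → 𝟙 a ≤ 𝟙 b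
𝟙-mono {false} _ = z≤n
𝟙-mono {true} {false} a⇒b = ⊥-elim (a⇒b _)
𝟙-mono {true} {true} _ = ≤-refl

module IndependentSets {n} (G : Graph n) where

  Independent : Vec Bool n → Set
  Independent S = ∀ i j → T (lookup S i) → T (lookup S j) → ¬ T (adj G i j)

  _⊆_ : Vec Bool n → (Fin n → Bool) → Set
  S ⊆ U = ∀ i → T (lookup S i) → T (U i)

  _⊆ᵇ_ : Vec Bool n → (Fin n → Bool) → Bool
  S ⊆ᵇ U = all (λ i → not (lookup S i) ∨ U i) (allFin n)

  independentIn : (Fin n → Bool) → Vec Bool n → Bool
  independentIn U S = isIndependent G S ∧ S ⊆ᵇ U

  T-isIndependent : ∀ S → T (isIndependent G S) ⇔ Independent S
  T-isIndependent S = mk⇔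
    (λ t i j → to T-not-∧∧ (to (T-all-allFin _) (to (T-all-allFin _) t i) j))
    (λ indep → from (T-all-allFin _) (λ i → from (T-all-allFin _) (λ j → from T-not-∧∧ (indep i j))))

  T-⊆ᵇ : ∀ S U → T (S ⊆ᵇ U) ⇔ S ⊆ U
  T-⊆ᵇ S U = mk⇔ (λ t i → to T-not-∨ (to (T-all-allFin _) t i)) (λ sub → from (T-all-allFin _) (λ i → from T-not-∨ (sub i)))

  T-independentIn : ∀ U S → T (independentIn U S) ⇔ (Independent S × S ⊆ U)
  T-independentIn U S = mk⇔
    (λ t → let indep , sub = to T-∧ t in to (T-isIndependent S) indep , to (T-⊆ᵇ S U) sub)
    (λ (indep , sub) → from T-∧ (from (T-isIndependent S) indep , from (T-⊆ᵇ S U) sub))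

  indepCountIn : (Fin n → Bool) → ℕ
  indepCountIn U = ∑ₛ n (𝟙 ∘ independentIn U)

  indepCountIn-full : indepCountIn (λ _ → true) ≡ indepCount G
  indepCountIn-full = sym (begin-equality
    length (filter (λ S → T? (isIndependent G S)) (allSubsets n))   ≡⟨ length-filter (isIndependent G) (allSubsets n) ⟩
    sum (map (𝟙 ∘ isIndependent G) (allSubsets n))                  ≡⟨ sum-allSubsets n (𝟙 ∘ isIndependent G) ⟩
    ∑ₛ n (𝟙 ∘ isIndependent G)                                      ≡⟨ ∑ₛ-cong n (λ S → cong 𝟙 (T-⇔⇒≡ (λ t → from T-∧ (t , from (T-⊆ᵇ S _) (λ _ _ → _))) (proj₁ ∘ to T-∧))) ⟩
    indepCountIn (λ _ → true)                                       ∎)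

  1≤indepCountIn : ∀ U → 1 ≤ indepCountIn U
  1≤indepCountIn U = subst (_≤ indepCountIn U) (cong 𝟙 (T-⇔⇒≡ {b = true} _ (λ _ → from (T-independentIn U (replicate n false)) (empty-independent , empty-⊆))))
                       (∑ₛ-≥-empty n (𝟙 ∘ independentIn U))
    where
    ∉-empty : ∀ i → ¬ T (lookup (replicate n false) i)
    ∉-empty i t = subst T (lookup-replicate i false) t
    empty-independent : Independent (replicate n false)
    empty-independent i _ i∈∅ = ⊥-elim (∉-empty i i∈∅)
    empty-⊆ : replicate n false ⊆ U
    empty-⊆ i i∈∅ = ⊥-elim (∉-empty i i∈∅)

  _∖_ : (Fin n → Bool) → Fin n → Fin n → Bool
  (U ∖ v) u = U u ∧ not (does (u ≟ v))

  _∖N[_] : (Fin n → Bool) → Fin n → Fin n → Bool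
  (U ∖N[ v ]) u = (U ∖ v) u ∧ not (adj G v u)

  ∈-∖ : ∀ U v u → T ((U ∖ v) u) ⇔ (T (U u) × u ≢ v)
  ∈-∖ U v u = mk⇔ (λ t → let u∈U , u≢v = to T-∧ t in u∈U , to T-not-≟ u≢v)
                  (λ (u∈U , u≢v) → from T-∧ (u∈U , from T-not-≟ u≢v))

  ∈-∖N : ∀ U v u → T ((U ∖N[ v ]) u) ⇔ (T ((U ∖ v) u) × ¬ T (adj G v u))
  ∈-∖N U v u = mk⇔ (λ t → let u∈U∖v , ¬adj = to T-∧ t in u∈U∖v , to T-not ¬adj)
                   (λ (u∈U∖v , ¬adj) → from T-∧ (u∈U∖v , from T-not ¬adj))

  independentIn-∉ : ∀ U S v → T (lookup S v) → ¬ T (U v) → independentIn U S ≡ false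
  independentIn-∉ U S v v∈S v∉U = ¬T⇒≡false (λ t → v∉U (proj₂ (to (T-independentIn U S) t) v v∈S))

  independentIn-∖ : ∀ U v S → ¬ T (lookup S v) → independentIn U S ≡ independentIn (U ∖ v) S
  independentIn-∖ U v S v∉S = T-⇔⇒≡
    (λ t → let indep , S⊆U = to (T-independentIn U S) t in
      from (T-independentIn (U ∖ v) S) (indep , λ i i∈S → from (∈-∖ U v i) (S⊆U i i∈S , λ { refl → v∉S i∈S })))
    (λ t → let indep , S⊆U∖v = to (T-independentIn (U ∖ v) S) t in
      from (T-independentIn U S) (indep , λ i i∈S → proj₁ (to (∈-∖ U v i) (S⊆U∖v i i∈S))))

  module Insertion (U : Fin n → Bool) (v : Fin n) (S : Vec Bool n) (v∉S : ¬ T (lookup S v)) where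
    S⁺ = updateAt S v not

    v∈S⁺ : T (lookup S⁺ v)
    v∈S⁺ = subst T (sym (lookup∘updateAt v S)) (from T-not v∉S)

    lookup-S⁺ : ∀ {i} → i ≢ v → lookup S⁺ i ≡ lookup S i
    lookup-S⁺ {i} i≢v = lookup∘updateAt′ i v i≢v S

    S⊆S⁺ : ∀ {i} → T (lookup S i) → T (lookup S⁺ i)
    S⊆S⁺ i∈S = subst T (sym (lookup-S⁺ λ { refl → v∉S i∈S })) i∈S

    independentIn-S⁺⇒ : T (independentIn U S⁺) → T (independentIn (U ∖N[ v ]) S)
    independentIn-S⁺⇒ t = from (T-independentIn (U ∖N[ v ]) S) (indep , S⊆U∖N[v])
      where
      indep⁺ = proj₁ (to (T-independentIn U S⁺) t)
      S⁺⊆U = proj₂ (to (T-independentIn U S⁺) t)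
      indep : Independent S
      indep i j i∈S j∈S = indep⁺ i j (S⊆S⁺ i∈S) (S⊆S⁺ j∈S)
      S⊆U∖N[v] : S ⊆ (U ∖N[ v ])
      S⊆U∖N[v] i i∈S = from (∈-∖N U v i)
        (from (∈-∖ U v i) (S⁺⊆U i (S⊆S⁺ i∈S) , λ { refl → v∉S i∈S }) , indep⁺ v i v∈S⁺ (S⊆S⁺ i∈S))

    ⇒independentIn-S⁺ : T (U v) → T (independentIn (U ∖N[ v ]) S) → T (independentIn U S⁺)
    ⇒independentIn-S⁺ v∈U t = from (T-independentIn U S⁺) (indep⁺ , S⁺⊆U)
      where
      indep = proj₁ (to (T-independentIn (U ∖N[ v ]) S) t)
      S⊆U∖N[v] = proj₂ (to (T-independentIn (U ∖N[ v ]) S) t)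
      from-S⁺ : ∀ {i} → i ≢ v → T (lookup S⁺ i) → T (lookup S i)
      from-S⁺ i≢v = subst T (lookup-S⁺ i≢v)
      non-adjacent : ∀ {i} → T (lookup S i) → ¬ T (adj G v i)
      non-adjacent {i} i∈S = proj₂ (to (∈-∖N U v i) (S⊆U∖N[v] i i∈S))
      indep⁺ : Independent S⁺
      indep⁺ i j i∈S⁺ j∈S⁺ with i ≟ v | j ≟ v
      ... | yes refl | yes refl = subst T (irrefl G i)
      ... | yes refl | no j≢v = non-adjacent (from-S⁺ j≢v j∈S⁺)
      ... | no i≢v | yes refl = non-adjacent (from-S⁺ i≢v i∈S⁺) ∘ subst T (Graph.sym G i j)
      ... | no i≢v | no j≢v = indep i j (from-S⁺ i≢v i∈S⁺) (from-S⁺ j≢v j∈S⁺)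
      S⁺⊆U : S⁺ ⊆ U
      S⁺⊆U i i∈S⁺ with i ≟ v
      ... | yes refl = v∈U
      ... | no i≢v = proj₁ (to (∈-∖ U v i) (proj₁ (to (∈-∖N U v i) (S⊆U∖N[v] i (from-S⁺ i≢v i∈S⁺)))))

  independentIn-insert : ∀ U v S → T (U v) → ¬ T (lookup S v) →
    independentIn U (updateAt S v not) ≡ independentIn (U ∖N[ v ]) S
  independentIn-insert U v S v∈U v∉S = T-⇔⇒≡ independentIn-S⁺⇒ (⇒independentIn-S⁺ v∈U)
    where open Insertion U v S v∉S

  indepCountIn-∖ : ∀ U v → T (U v) → indepCountIn U ≡ indepCountIn (U ∖ v) + indepCountIn (U ∖N[ v ])
  indepCountIn-∖ U v v∈U = begin-equality
    ∑ₛ n (𝟙 ∘ independentIn U)       ≡⟨ ∑ₛ-cong n split ⟩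
    ∑ₛ n (λ S → A S + B S)            ≡⟨ ∑ₛ-distrib-+ n A B ⟩
    ∑ₛ n A + ∑ₛ n B                   ≡⟨ cong₂ _+_ (∑ₛ-cong n without-v) (trans (sym (∑ₛ-toggle n v B)) (∑ₛ-cong n with-v)) ⟩
    indepCountIn (U ∖ v) + indepCountIn (U ∖N[ v ]) ∎
    where
    A B : Vec Bool n → ℕ
    A S = if lookup S v then 0 else 𝟙 (independentIn U S)
    B S = if lookup S v then 𝟙 (independentIn U S) else 0
    split : ∀ S → 𝟙 (independentIn U S) ≡ A S + B S
    split S with lookup S v
    ... | true = refl
    ... | false = sym (+-identityʳ _)
    v∉U∖v : ¬ T ((U ∖ v) v)
    v∉U∖v t = proj₂ (to (∈-∖ U v v) t) refl
    without-v : ∀ S → A S ≡ 𝟙 (independentIn (U ∖ v) S)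
    without-v S with lookup S v in v∈?S
    ... | true = sym (cong 𝟙 (independentIn-∉ (U ∖ v) S v (subst T (sym v∈?S) _) v∉U∖v))
    ... | false = cong 𝟙 (independentIn-∖ U v S (subst T v∈?S))
    with-v : ∀ S → B (updateAt S v not) ≡ 𝟙 (independentIn (U ∖N[ v ]) S)
    with-v S rewrite lookup∘updateAt v {not} S with lookup S v in v∈?S
    ... | true = sym (cong 𝟙 (independentIn-∉ (U ∖N[ v ]) S v (subst T (sym v∈?S) _) (v∉U∖v ∘ proj₁ ∘ to (∈-∖N U v v))))
    ... | false = cong 𝟙 (independentIn-insert U v S v∈U (subst T v∈?S))

  size : (Fin n → Bool) → ℕ
  size U = ∑ (λ j → 𝟙 (U j))

  degIn : (Fin n → Bool) → Fin n → ℕ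
  degIn U u = ∑ (λ j → 𝟙 (adj G u j ∧ U j))

  ∑-∖ : ∀ U v (h : Fin n → Bool) → T (U v) → ∑ (λ j → 𝟙 (h j ∧ U j)) ≡ ∑ (λ j → 𝟙 (h j ∧ (U ∖ v) j)) + 𝟙 (h v)
  ∑-∖ U v h v∈U = begin-equality
    ∑ (λ j → 𝟙 (h j ∧ U j))                                                ≡⟨ ∑-cong split ⟩
    ∑ (λ j → 𝟙 (h j ∧ (U ∖ v) j) + (if does (j ≟ v) then 𝟙 (h v) else 0)) ≡⟨ ∑-distrib-+ (λ j → 𝟙 (h j ∧ (U ∖ v) j)) _ ⟩
    ∑ (λ j → 𝟙 (h j ∧ (U ∖ v) j)) + ∑ (λ j → if does (j ≟ v) then 𝟙 (h v) else 0)
                                                                            ≡⟨ cong (∑ (λ j → 𝟙 (h j ∧ (U ∖ v) j)) +_) (∑-point v (𝟙 (h v))) ⟩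
    ∑ (λ j → 𝟙 (h j ∧ (U ∖ v) j)) + 𝟙 (h v)                                ∎
    where
    split : ∀ j → 𝟙 (h j ∧ U j) ≡ 𝟙 (h j ∧ (U ∖ v) j) + (if does (j ≟ v) then 𝟙 (h v) else 0)
    split j with j ≟ v | U j in j∈?U
    ... | yes refl | false = ⊥-elim (subst T j∈?U v∈U)
    ... | yes refl | true with h j
    ...   | true = refl
    ...   | false = refl
    split j | no _ | true = sym (+-identityʳ _)
    split j | no _ | false = sym (+-identityʳ _)

  size-∖ : ∀ U v → T (U v) → size U ≡ suc (size (U ∖ v))
  size-∖ U v v∈U = trans (∑-∖ U v (λ _ → true) v∈U) (+-comm (size (U ∖ v)) 1)

  degIn-∖ : ∀ U v u → T (U v) → degIn U u ≡ degIn (U ∖ v) u + 𝟙 (adj G u v)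
  degIn-∖ U v u = ∑-∖ U v (adj G u)

  size-mono : ∀ {W U} → (∀ j → T (W j) → T (U j)) → size W ≤ size U
  size-mono W⊆U = ∑-mono (λ j → 𝟙-mono (W⊆U j))

  degIn-mono : ∀ {W U} u → (∀ j → T (W j) → T (U j)) → degIn W u ≤ degIn U u
  degIn-mono u W⊆U = ∑-mono (λ j → 𝟙-mono (∧-monoʳ-T (W⊆U j)))

  degIn≤degree : ∀ U u → degIn U u ≤ degree G u
  degIn≤degree U u = begin
    degIn U u                                          ≤⟨ ∑-mono (λ j → 𝟙-mono {adj G u j ∧ U j} (proj₁ ∘ to T-∧)) ⟩
    ∑ (𝟙 ∘ adj G u)                                    ≡⟨ sum-tabulate (𝟙 ∘ adj G u) ⟨
    sum (tabulate (𝟙 ∘ adj G u))                       ≡⟨ cong sum (map-tabulate id (𝟙 ∘ adj G u)) ⟨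
    degree G u                                         ∎

argmax : ∀ {m} (U : Fin m → Bool) (g : Fin m → ℕ) →
  (∀ u → ¬ T (U u)) ⊎ ∃ λ v → T (U v) × (∀ u → T (U u) → g u ≤ g v)
argmax {zero} U g = inj₁ (λ ())
argmax {suc m} U g with argmax (U ∘ suc) (g ∘ suc) | U zero in 0∈?U
... | inj₁ none | false = inj₁ λ { zero → subst T 0∈?U ; (suc u) → none u }
... | inj₁ none | true = inj₂ (zero , subst T (sym 0∈?U) _ , λ { zero _ → ≤-refl ; (suc u) u∈U → ⊥-elim (none u u∈U) })
... | inj₂ (v , v∈U , v-max) | false = inj₂ (suc v , v∈U , λ { zero 0∈U → ⊥-elim (subst T 0∈?U 0∈U) ; (suc u) → v-max u })
... | inj₂ (v , v∈U , v-max) | true with g zero ≤? g (suc v)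
...   | yes g0≤gv = inj₂ (suc v , v∈U , λ { zero _ → g0≤gv ; (suc u) → v-max u })
...   | no g0≰gv = inj₂ (zero , subst T (sym 0∈?U) _ , λ { zero _ → ≤-refl ; (suc u) u∈U → ≤-trans (v-max u u∈U) (<⇒≤ (≰⇒> g0≰gv)) })

-- Φ U ≤ i(G[U])^M is the scaled form of i(G[U]) ≥ ∏_{u ∈ U} (2 + deg_U u)^(1/(1 + deg_U u)).
module Bound {n} (G : Graph n) (d : ℕ) (Δ≤d : ∀ v → degree G v ≤ d) where
  open IndependentSets G
  open Potential d

  φ : (Fin n → Bool) → Fin n → ℕ
  φ U u = if U u then f (degIn U u) else 1

  Φ : (Fin n → Bool) → ℕ
  Φ U = ∏ (φ U)

  degIn≤d : ∀ U u → degIn U u ≤ d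
  degIn≤d U u = ≤-trans (degIn≤degree U u) (Δ≤d u)

  -- Deleting a vertex v of maximum degree: the weights ρ and μ spread the factors ((1 + a)^(1 + a))^M
  -- and ((2 + a)^(2 + a))^M over v and its neighbours so that the inequality holds vertex by vertex.
  module Deletion (U : Fin n → Bool) (v : Fin n) (v∈U : T (U v)) (v-max : ∀ u → T (U u) → degIn U u ≤ degIn U v) where
    a = degIn U v
    c = f a ^ (2 + a)

    ρ μ : Fin n → ℕ
    ρ u = if adj G v u ∧ U u then neighbourWeight a else 1
    μ u = (if does (u ≟ v) then c else 1) * (if adj G v u ∧ U u then c else 1)

    a≤d : a ≤ d
    a≤d = degIn≤d U v

    U∖v⊆U : ∀ j → T ((U ∖ v) j) → T (U j)
    U∖v⊆U j = proj₁ ∘ to (∈-∖ U v j)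

    U∖N[v]⊆U : ∀ j → T ((U ∖N[ v ]) j) → T (U j)
    U∖N[v]⊆U j = U∖v⊆U j ∘ proj₁ ∘ to (∈-∖N U v j)

    non-neighbour : ∀ u → adj G u v ≡ false →
      1 * f (degIn U u) ^ (2 + a) ≤ 1 * 1 * f (degIn (U ∖ v) u) ^ (1 + a) * f (degIn (U ∖N[ v ]) u)
    non-neighbour u uv≡false = begin
      1 * (f k * f k ^ (1 + a))       ≤⟨ *-monoʳ-≤ 1 (*-monoˡ-≤ (f k ^ (1 + a)) fk≤fk₂) ⟩
      1 * (f k₂ * f k ^ (1 + a))      ≡⟨ e (f k₂) (f k ^ (1 + a)) ⟩
      1 * 1 * f k ^ (1 + a) * f k₂    ≡⟨ cong (λ m → 1 * 1 * f m ^ (1 + a) * f k₂) k≡k₁ ⟩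
      1 * 1 * f (degIn (U ∖ v) u) ^ (1 + a) * f k₂ ∎
      where
      k = degIn U u
      k₂ = degIn (U ∖N[ v ]) u
      k≡k₁ : k ≡ degIn (U ∖ v) u
      k≡k₁ = trans (degIn-∖ U v u v∈U) (trans (cong (λ b → degIn (U ∖ v) u + 𝟙 b) uv≡false) (+-identityʳ _))
      fk≤fk₂ : f k ≤ f k₂
      fk≤fk₂ = antitone (degIn-mono u U∖N[v]⊆U) (degIn≤d U u)
      e : ∀ z y → 1 * (z * y) ≡ 1 * 1 * y * z
      e = solve-∀

    neighbour : ∀ u → T (U u) → adj G u v ≡ true →
      neighbourWeight a * f (degIn U u) ^ (2 + a) ≤ 1 * c * f (degIn (U ∖ v) u) ^ (1 + a) * 1
    neighbour u u∈U uv≡true = begin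
      neighbourWeight a * f (degIn U u) ^ (2 + a)   ≡⟨ cong (λ m → neighbourWeight a * f m ^ (2 + a)) k≡1+b ⟩
      neighbourWeight a * f (suc b) ^ (2 + a)       ≤⟨ neighbour-exchange (subst (_≤ a) k≡1+b (v-max u u∈U)) a≤d ⟩
      c * f b ^ (1 + a)                             ≡⟨ e c (f b ^ (1 + a)) ⟩
      1 * c * f b ^ (1 + a) * 1                     ∎
      where
      b = degIn (U ∖ v) u
      k≡1+b : degIn U u ≡ suc b
      k≡1+b = trans (degIn-∖ U v u v∈U) (trans (cong (λ x → b + 𝟙 x) uv≡true) (+-comm b 1))
      e : ∀ c y → c * y ≡ 1 * c * y * 1
      e = solve-∀

    unit-factors : ∀ x y z → x ≡ 1 → y ≡ 1 → z * x ≡ z * 1 * y * 1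
    unit-factors _ _ z refl refl = e z
      where
      e : ∀ z → z * 1 ≡ z * 1 * 1 * 1
      e = solve-∀

    unit-factors-at-v : ∀ y → y ≡ 1 → 1 * c ≡ c * 1 * y * 1
    unit-factors-at-v _ refl = e c
      where
      e : ∀ c → 1 * c ≡ c * 1 * 1 * 1
      e = solve-∀

    pointwise : ∀ u → ρ u * φ U u ^ (2 + a) ≤ μ u * φ (U ∖ v) u ^ (1 + a) * φ (U ∖N[ v ]) u
    pointwise u with u ≟ v | U u in u∈?U | adj G v u in vu
    ... | yes refl | false | _     = ⊥-elim (subst T u∈?U v∈U)
    ... | yes refl | true  | true  = ⊥-elim (subst T (trans (sym vu) (irrefl G v)) _)
    ... | yes refl | true  | false = ≤-reflexive (unit-factors-at-v (1 ^ (1 + a)) (^-zeroˡ (1 + a)))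
    ... | no _     | false | true  = ≤-reflexive (unit-factors _ _ 1 (^-zeroˡ (2 + a)) (^-zeroˡ (1 + a)))
    ... | no _     | false | false = ≤-reflexive (unit-factors _ _ 1 (^-zeroˡ (2 + a)) (^-zeroˡ (1 + a)))
    ... | no _     | true  | false = non-neighbour u (trans (Graph.sym G u v) vu)
    ... | no _     | true  | true  = neighbour u (subst T (sym u∈?U) _) (trans (Graph.sym G u v) vu)

    Φ-recurrence : ((1 + a) ^ (1 + a)) ^ M * Φ U ^ (2 + a) ≤ ((2 + a) ^ (2 + a)) ^ M * Φ (U ∖ v) ^ (1 + a) * Φ (U ∖N[ v ])
    Φ-recurrence = subst₂ _≤_ lhs rhs (∏-mono pointwise)
      where
      lhs : ∏ (λ u → ρ u * φ U u ^ (2 + a)) ≡ ((1 + a) ^ (1 + a)) ^ M * Φ U ^ (2 + a)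
      lhs = begin-equality
        ∏ (λ u → ρ u * φ U u ^ (2 + a))          ≡⟨ ∏-distrib-* ρ (λ u → φ U u ^ (2 + a)) ⟩
        ∏ ρ * ∏ (λ u → φ U u ^ (2 + a))          ≡⟨ cong₂ _*_ (∏-indicator (λ u → adj G v u ∧ U u) (neighbourWeight a)) (∏-^ (φ U) (2 + a)) ⟩
        neighbourWeight a ^ a * Φ U ^ (2 + a)    ≡⟨ cong (_* Φ U ^ (2 + a)) (neighbourWeight^k a≤d) ⟩
        ((1 + a) ^ (1 + a)) ^ M * Φ U ^ (2 + a)  ∎
      rhs : ∏ (λ u → μ u * φ (U ∖ v) u ^ (1 + a) * φ (U ∖N[ v ]) u) ≡ ((2 + a) ^ (2 + a)) ^ M * Φ (U ∖ v) ^ (1 + a) * Φ (U ∖N[ v ])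
      rhs = begin-equality
        ∏ (λ u → μ u * φ (U ∖ v) u ^ (1 + a) * φ (U ∖N[ v ]) u)
          ≡⟨ ∏-distrib-* (λ u → μ u * φ (U ∖ v) u ^ (1 + a)) (φ (U ∖N[ v ])) ⟩
        ∏ (λ u → μ u * φ (U ∖ v) u ^ (1 + a)) * Φ (U ∖N[ v ])
          ≡⟨ cong (_* Φ (U ∖N[ v ])) (∏-distrib-* μ (λ u → φ (U ∖ v) u ^ (1 + a))) ⟩
        ∏ μ * ∏ (λ u → φ (U ∖ v) u ^ (1 + a)) * Φ (U ∖N[ v ])
          ≡⟨ cong (λ m → m * ∏ (λ u → φ (U ∖ v) u ^ (1 + a)) * Φ (U ∖N[ v ])) ∏μ ⟩
        ((2 + a) ^ (2 + a)) ^ M * ∏ (λ u → φ (U ∖ v) u ^ (1 + a)) * Φ (U ∖N[ v ])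
          ≡⟨ cong (λ m → ((2 + a) ^ (2 + a)) ^ M * m * Φ (U ∖N[ v ])) (∏-^ (φ (U ∖ v)) (1 + a)) ⟩
        ((2 + a) ^ (2 + a)) ^ M * Φ (U ∖ v) ^ (1 + a) * Φ (U ∖N[ v ]) ∎
        where
        ∏μ : ∏ μ ≡ ((2 + a) ^ (2 + a)) ^ M
        ∏μ = begin-equality
          ∏ μ      ≡⟨ ∏-distrib-* (λ u → if does (u ≟ v) then c else 1) (λ u → if adj G v u ∧ U u then c else 1) ⟩
          ∏ (λ u → if does (u ≟ v) then c else 1) * ∏ (λ u → if adj G v u ∧ U u then c else 1)
                   ≡⟨ cong₂ _*_ (∏-point v c) (∏-indicator (λ u → adj G v u ∧ U u) c) ⟩
          c ^ (1 + a)   ≡⟨ [f^[2+k]]^[1+k] a≤d ⟩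
          ((2 + a) ^ (2 + a)) ^ M ∎

  Φ-empty : ∀ U → (∀ u → ¬ T (U u)) → Φ U ≤ indepCountIn U ^ M
  Φ-empty U U-empty = begin
    Φ U               ≡⟨ ∏-cong (λ u → cong (λ b → if b then f (degIn U u) else 1) (¬T⇒≡false (U-empty u))) ⟩
    ∏ {n} (λ _ → 1)   ≡⟨ ∏-const n 1 ⟩
    1 ^ n             ≡⟨ ^-zeroˡ n ⟩
    1                 ≡⟨ ^-zeroˡ M ⟨
    1 ^ M             ≤⟨ ^-monoˡ-≤ M (1≤indepCountIn U) ⟩
    indepCountIn U ^ M ∎

  Φ≤indepCountIn^M : ∀ k U → size U ≤ k → Φ U ≤ indepCountIn U ^ M
  Φ≤indepCountIn^M k U size≤k with argmax U (degIn U)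
  ... | inj₁ U-empty = Φ-empty U U-empty
  Φ≤indepCountIn^M zero U size≤0 | inj₂ (v , v∈U , _) = contradiction (subst (_≤ 0) (size-∖ U v v∈U) size≤0) λ ()
  Φ≤indepCountIn^M (suc k) U size≤1+k | inj₂ (v , v∈U , v-max) =
    subst (λ m → Φ U ≤ m ^ M) (sym (indepCountIn-∖ U v v∈U))
      (am-gm-recurrence M a (indepCountIn (U ∖ v)) (indepCountIn (U ∖N[ v ])) (Φ U) (Φ (U ∖ v)) (Φ (U ∖N[ v ]))
        (Φ≤indepCountIn^M k (U ∖ v) size₁) (Φ≤indepCountIn^M k (U ∖N[ v ]) size₂) Φ-recurrence)
    where
    open Deletion U v v∈U v-max
    size₁ : size (U ∖ v) ≤ k
    size₁ = s≤s⁻¹ (subst (_≤ suc k) (size-∖ U v v∈U) size≤1+k)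
    size₂ : size (U ∖N[ v ]) ≤ k
    size₂ = ≤-trans (size-mono (λ j → proj₁ ∘ to (∈-∖N U v j))) size₁

  f[d]^n≤Φ : f d ^ n ≤ Φ (λ _ → true)
  f[d]^n≤Φ = subst (_≤ Φ (λ _ → true)) (∏-const n (f d)) (∏-mono (λ u → antitone (degIn≤d (λ _ → true) u) ≤-refl))

mainTheorem5 : (n d : ℕ) → 1 ≤ n → (G : Graph n) → (∀ (v : Fin n) → degree G v ≤ d) →
    (d + 2) ^ n ≤ indepCount G ^ (d + 1)
mainTheorem5 n d _ G Δ≤d = subst₂ (λ x y → x ^ n ≤ indepCount G ^ y) (+-comm 2 d) (+-comm 1 d) (^-cancelˡ-≤ M (begin
    ((2 + d) ^ n) ^ M                        ≡⟨ ^-comm-exponents (2 + d) n M ⟩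
    ((2 + d) ^ M) ^ n                        ≡⟨ cong (_^ n) (f^[1+k] ≤-refl) ⟨
    (f d ^ suc d) ^ n                        ≡⟨ ^-comm-exponents (f d) (suc d) n ⟩
    (f d ^ n) ^ suc d                        ≤⟨ ^-monoˡ-≤ (suc d) f[d]^n≤Φ ⟩
    Φ full ^ suc d                           ≤⟨ ^-monoˡ-≤ (suc d) (Φ≤indepCountIn^M (size full) full ≤-refl) ⟩
    (indepCountIn full ^ M) ^ suc d          ≡⟨ cong (λ i → (i ^ M) ^ suc d) indepCountIn-full ⟩
    (indepCount G ^ M) ^ suc d               ≡⟨ ^-comm-exponents (indepCount G) M (suc d) ⟩
    (indepCount G ^ suc d) ^ M               ∎))
  where
  open Potential d
  open IndependentSets G
  open Bound G d Δ≤d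
  full : Fin n → Bool
  full _ = true
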